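{- Let $r,s\ge 2$ and let $X\subseteq V(K_r\,\square\, K_s)$. Then $X$ is a mutual-visibility set of $K_r\,\square\, K_s$ if and only if $|X\cap V(C)|\le 3$ for every induced $4$-cycle $C$ of $K_r\,\square\, K_s$.
   Context: $K_k$ is the complete graph on $k$ vertices. The Cartesian product $G\,\square\, H$ has vertex set $V(G)\times V(H)$, with $(g,h)\sim(g',h')$ iff ($gg'\in E(G)$ and $h=h'$) or ($g=g'$ and $hh'\in E(H)$). For a connected graph $G$ and $X\subseteq V(G)$, two vertices $x,y\in X$ are $X$-visible if there is a shortest $x,y$-path $P$ in $G$ with $V(P)\cap X=\{x,y\}$; $X$ is a mutual-visibility set if every two vertices of $X$ are $X$-visible. -}

module Defs where

open import Level using (0ℓ)
open import Data.Nat using (ℕ; zero; suc; _≤_)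
open import Data.Fin using (Fin)
open import Data.Bool using (Bool; true)
open import Data.List using (List; []; _∷_; filterᵇ; length)
open import Data.List.Membership.Propositional using (_∈_)
open import Data.Product using (_×_; _,_; Σ; ∃; ∃-syntax)
open import Data.Sum using (_⊎_)
open import Relation.Binary.PropositionalEquality using (_≡_)
open import Relation.Nullary using (¬_)

record Graph : Set₁ where
  field
    V   : Set
    Adj : V → V → Set

open Graph public

K : ℕ → Graph
K k = record { V = Fin k ; Adj = λ i j → ¬ (i ≡ j) }

_□_ : Graph → Graph → Graph
G □ H = record
  { V   = V G × V H
  ; Adj = λ { (g , h) (g' , h') →
              (Adj G g g' × h ≡ h') ⊎ (g ≡ g' × Adj H h h') }
  }

data Walk (G : Graph) : V G → V G → ℕ → Set where
  here : ∀ {x} → Walk G x x zero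
  step : ∀ {x y z n} → Adj G x y → Walk G y z n → Walk G x z (suc n)

verts : ∀ {G x y n} → Walk G x y n → List (V G)
verts {x = x} here       = x ∷ []
verts {x = x} (step _ w) = x ∷ verts w

-- A shortest x,y-walk (necessarily a path): no x,y-walk is shorter.
IsShortest : ∀ {G x y n} → Walk G x y n → Set
IsShortest {G} {x} {y} {n} _ = ∀ m → Walk G x y m → n ≤ m

VSubset : Graph → Set
VSubset G = V G → Bool

_∈ˢ_ : ∀ {G} → V G → VSubset G → Set
v ∈ˢ X = X v ≡ true

Visible : (G : Graph) → VSubset G → V G → V G → Set
Visible G X x y =
  Σ ℕ λ n → Σ (Walk G x y n) λ P →
    IsShortest P ×
    (∀ v → v ∈ verts P → _∈ˢ_ {G} v X → (v ≡ x ⊎ v ≡ y))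

MutualVisibility : (G : Graph) → VSubset G → Set
MutualVisibility G X =
  ∀ x y → _∈ˢ_ {G} x X → _∈ˢ_ {G} y X → ¬ (x ≡ y) → Visible G X x y

record InducedC4 (G : Graph) : Set where
  field
    v0 v1 v2 v3 : V G
    d01 : ¬ v0 ≡ v1
    d02 : ¬ v0 ≡ v2
    d03 : ¬ v0 ≡ v3
    d12 : ¬ v1 ≡ v2
    d13 : ¬ v1 ≡ v3
    d23 : ¬ v2 ≡ v3
    e01 : Adj G v0 v1
    e12 : Adj G v1 v2
    e23 : Adj G v2 v3
    e30 : Adj G v3 v0
    n02 : ¬ Adj G v0 v2
    n13 : ¬ Adj G v1 v3

cycleVerts : ∀ {G} → InducedC4 G → List (V G)
cycleVerts C = v0 ∷ v1 ∷ v2 ∷ v3 ∷ []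
  where open InducedC4 C

∣_∩C_∣ : ∀ {G} → VSubset G → InducedC4 G → ℕ
∣ X ∩C C ∣ = length (filterᵇ X (cycleVerts C))

{-# OPTIONS --safe #-}
module Submission where

open import Defs
open import Data.Nat using (ℕ; zero; suc; _≤_; _<_; z≤n; s≤s)
open import Data.Nat.Properties using (≤-pred; n≮n)
open import Data.Bool using (Bool; true; T?)
open import Data.Bool.Properties using (T-≡) renaming (_≟_ to _≟ᵇ_)
open import Data.Fin using (Fin)
open import Data.Fin.Properties using (_≟_)
open import Data.List using ([]; _∷_; filterᵇ; length)
open import Data.List.Properties using (filter-all; filter-notAll)
open import Data.List.Membership.Propositional using (_∈_)
open import Data.List.Relation.Unary.All as All using (All; []; _∷_)
open import Data.List.Relation.Unary.All.Properties using (¬All⇒Any¬)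
open import Data.List.Relation.Unary.Any using (here; there)
open import Data.Product using (_×_; _,_; Σ; proj₁; proj₂)
open import Data.Sum using (_⊎_; inj₁; inj₂; [_,_])
open import Data.Empty using (⊥-elim)
open import Function using (_∘_)
open import Function.Bundles using (_⇔_; mk⇔; Equivalence)
open import Relation.Binary.Definitions using (Symmetric; Irreflexive)
open import Relation.Binary.PropositionalEquality using (_≡_; refl; sym; trans; cong; subst)
open import Relation.Nullary using (¬_; yes; no)

-- Two vertices of K_r □ K_s at distance 2 differ in both coordinates, so their
-- only common neighbours are the two remaining corners of the rectangle they span.
-- If both corners lie in X the rectangle is an induced C₄ inside X; otherwise the
-- path through a corner outside X witnesses visibility. Conversely, in an induced
-- C₄ every shortest path between opposite vertices passes through one of the
-- other two, so all four cannot lie in X.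

module _ {A : Set} (X : A → Bool) where

  length-filterᵇ-all : ∀ {xs} → All (λ x → X x ≡ true) xs →
    length (filterᵇ X xs) ≡ length xs
  length-filterᵇ-all =
    cong length ∘ filter-all (T? ∘ X) ∘ All.map (Equivalence.from T-≡)

  length-filterᵇ-notAll : ∀ xs → ¬ All (λ x → X x ≡ true) xs →
    length (filterᵇ X xs) < length xs
  length-filterᵇ-notAll xs ¬all =
    filter-notAll (T? ∘ X) xs (¬All⇒Any¬ (T? ∘ X) xs (¬all ∘ All.map (Equivalence.to T-≡)))

∣∩C∣≤3⇔¬All : ∀ {G} (X : VSubset G) (C : InducedC4 G) →
  ∣ X ∩C C ∣ ≤ 3 ⇔ (¬ All (λ v → X v ≡ true) (cycleVerts C))
∣∩C∣≤3⇔¬All X C = mk⇔ ≤3⇒¬All (≤-pred ∘ length-filterᵇ-notAll X (cycleVerts C))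
  where
  ≤3⇒¬All : ∣ X ∩C C ∣ ≤ 3 → ¬ All (λ v → X v ≡ true) (cycleVerts C)
  ≤3⇒¬All ≤3 all = n≮n 3 (subst (_≤ 3) (length-filterᵇ-all X all) ≤3)

module _ {G : Graph} where

  walk-length-zero : ∀ {x y} → Walk G x y 0 → x ≡ y
  walk-length-zero here = refl

  walk-length-one : ∀ {x y} → Walk G x y 1 → Adj G x y
  walk-length-one (step e here) = e

  walk≤2-middle : ∀ {x y n} (P : Walk G x y n) → n ≤ 2 → ¬ x ≡ y → ¬ Adj G x y →
    Σ (V G) λ m → Adj G x m × Adj G m y × m ∈ verts P
  walk≤2-middle here                        _                 x≢y _   = ⊥-elim (x≢y refl)
  walk≤2-middle (step e here)               _                 _   ¬xy = ⊥-elim (¬xy e)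
  walk≤2-middle (step e (step e′ here))     _                 _   _   = _ , e , e′ , there (here refl)
  walk≤2-middle (step _ (step _ (step _ _))) (s≤s (s≤s ())) _ _

  module _ (X : VSubset G) where

    edge-visible : ∀ {x y} → ¬ x ≡ y → Adj G x y → Visible G X x y
    edge-visible {x} {y} x≢y e = 1 , step e here , shortest , inside
      where
      shortest : ∀ n → Walk G x y n → 1 ≤ n
      shortest zero    w = ⊥-elim (x≢y (walk-length-zero w))
      shortest (suc n) _ = s≤s z≤n
      inside : ∀ v → v ∈ x ∷ y ∷ [] → X v ≡ true → v ≡ x ⊎ v ≡ y
      inside _ (here eq)         _ = inj₁ eq
      inside _ (there (here eq)) _ = inj₂ eq

    detour-visible : ∀ {x m y} → ¬ x ≡ y → ¬ Adj G x y →
      Adj G x m → Adj G m y → ¬ X m ≡ true → Visible G X x y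
    detour-visible {x} {m} {y} x≢y ¬xy xm my m∉X = 2 , step xm (step my here) , shortest , inside
      where
      shortest : ∀ n → Walk G x y n → 2 ≤ n
      shortest zero          w = ⊥-elim (x≢y (walk-length-zero w))
      shortest (suc zero)    w = ⊥-elim (¬xy (walk-length-one w))
      shortest (suc (suc n)) _ = s≤s (s≤s z≤n)
      inside : ∀ v → v ∈ x ∷ m ∷ y ∷ [] → X v ≡ true → v ≡ x ⊎ v ≡ y
      inside _ (here eq)                 _   = inj₁ eq
      inside _ (there (here refl))       v∈X = ⊥-elim (m∉X v∈X)
      inside _ (there (there (here eq))) _   = inj₂ eq

    visible⇒detour∉ : Irreflexive _≡_ (Adj G) → ∀ {x m y} → ¬ x ≡ y → ¬ Adj G x y →
      Adj G x m → Adj G m y → Visible G X x y →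
      Σ (V G) λ m′ → Adj G x m′ × Adj G m′ y × ¬ X m′ ≡ true
    visible⇒detour∉ irrefl x≢y ¬xy xm my (n , P , shortest , inside)
      with walk≤2-middle P (shortest 2 (step xm (step my here))) x≢y ¬xy
    ... | m′ , xm′ , m′y , m′∈P =
      m′ , xm′ , m′y , [ (λ eq → irrefl (sym eq) xm′) , (λ eq → irrefl eq m′y) ] ∘ inside m′ m′∈P

module _ {G H : Graph} where

  □-irreflexive : Irreflexive _≡_ (Adj G) → Irreflexive _≡_ (Adj H) →
    Irreflexive _≡_ (Adj (G □ H))
  □-irreflexive irrG _     refl (inj₁ (gg , _)) = irrG refl gg
  □-irreflexive _    irrH refl (inj₂ (_ , hh)) = irrH refl hh

  □-symmetric : Symmetric (Adj G) → Symmetric (Adj H) → Symmetric (Adj (G □ H))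
  □-symmetric symG _    (inj₁ (gg′ , h≡h′)) = inj₁ (symG gg′ , sym h≡h′)
  □-symmetric _    symH (inj₂ (g≡g′ , hh′)) = inj₂ (sym g≡g′ , symH hh′)

  □-common-neighbour : ∀ {a c b d m} → ¬ a ≡ c → ¬ b ≡ d →
    Adj (G □ H) (a , b) m → Adj (G □ H) m (c , d) → m ≡ (a , d) ⊎ m ≡ (c , b)
  □-common-neighbour _   b≢d (inj₁ (_ , refl)) (inj₁ (_ , refl)) = ⊥-elim (b≢d refl)
  □-common-neighbour _   _   (inj₁ (_ , refl)) (inj₂ (refl , _)) = inj₂ refl
  □-common-neighbour _   _   (inj₂ (refl , _)) (inj₁ (_ , refl)) = inj₁ refl
  □-common-neighbour a≢c _   (inj₂ (refl , _)) (inj₂ (refl , _)) = ⊥-elim (a≢c refl)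

K-irreflexive : ∀ k → Irreflexive _≡_ (Adj (K k))
K-irreflexive _ i≡j i≢j = i≢j i≡j

K-symmetric : ∀ k → Symmetric (Adj (K k))
K-symmetric _ i≢j = i≢j ∘ sym

module Rook (r s : ℕ) where

  G : Graph
  G = K r □ K s

  irreflexive : Irreflexive _≡_ (Adj G)
  irreflexive = □-irreflexive (K-irreflexive r) (K-irreflexive s)

  symmetric : Symmetric (Adj G)
  symmetric = □-symmetric (K-symmetric r) (K-symmetric s)

  nonadjacent-apart : ∀ {a c : Fin r} {b d : Fin s} → ¬ (a , b) ≡ (c , d) →
    ¬ Adj G (a , b) (c , d) → ¬ a ≡ c × ¬ b ≡ d
  nonadjacent-apart {a} {c} {b} {d} ne ¬adj with a ≟ c | b ≟ d
  ... | yes refl | yes refl = ⊥-elim (ne refl)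
  ... | yes refl | no b≢d   = ⊥-elim (¬adj (inj₂ (refl , b≢d)))
  ... | no a≢c   | yes refl = ⊥-elim (¬adj (inj₁ (a≢c , refl)))
  ... | no a≢c   | no b≢d   = a≢c , b≢d

  rectangle : ∀ {a c : Fin r} {b d : Fin s} → ¬ a ≡ c → ¬ b ≡ d → InducedC4 G
  rectangle {a} {c} {b} {d} a≢c b≢d = record
    { v0 = a , b ; v1 = a , d ; v2 = c , d ; v3 = c , b
    ; d01 = b≢d ∘ cong proj₂
    ; d02 = a≢c ∘ cong proj₁
    ; d03 = a≢c ∘ cong proj₁
    ; d12 = a≢c ∘ cong proj₁
    ; d13 = a≢c ∘ cong proj₁
    ; d23 = b≢d ∘ sym ∘ cong proj₂
    ; e01 = inj₂ (refl , b≢d)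
    ; e12 = inj₁ (a≢c , refl)
    ; e23 = inj₂ (refl , b≢d ∘ sym)
    ; e30 = inj₁ (a≢c ∘ sym , refl)
    ; n02 = λ { (inj₁ (_ , eq)) → b≢d eq ; (inj₂ (eq , _)) → a≢c eq }
    ; n13 = λ { (inj₁ (_ , eq)) → b≢d (sym eq) ; (inj₂ (eq , _)) → a≢c eq }
    }

  C4-common-neighbour : (C : InducedC4 G) → let open InducedC4 C in
    ∀ {m} → Adj G v0 m → Adj G m v2 → m ≡ v1 ⊎ m ≡ v3
  C4-common-neighbour C {m} v0m mv2 with nonadjacent-apart d02 n02
    where open InducedC4 C
  ... | a≢c , b≢d =
    among-two (□-common-neighbour {K r} {K s} a≢c b≢d v0m mv2)
              (□-common-neighbour {K r} {K s} a≢c b≢d e01 e12)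
              (□-common-neighbour {K r} {K s} a≢c b≢d (symmetric e30) (symmetric e23))
              d13
    where
    open InducedC4 C
    among-two : ∀ {A : Set} {x y z p q : A} → x ≡ p ⊎ x ≡ q → y ≡ p ⊎ y ≡ q →
      z ≡ p ⊎ z ≡ q → ¬ y ≡ z → x ≡ y ⊎ x ≡ z
    among-two (inj₁ x≡p) (inj₁ y≡p) _          _   = inj₁ (trans x≡p (sym y≡p))
    among-two (inj₂ x≡q) (inj₂ y≡q) _          _   = inj₁ (trans x≡q (sym y≡q))
    among-two (inj₁ x≡p) (inj₂ _)   (inj₁ z≡p) _   = inj₂ (trans x≡p (sym z≡p))
    among-two (inj₂ x≡q) (inj₁ _)   (inj₂ z≡q) _   = inj₂ (trans x≡q (sym z≡q))
    among-two (inj₁ _)   (inj₂ y≡q) (inj₂ z≡q) y≢z = ⊥-elim (y≢z (trans y≡q (sym z≡q)))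
    among-two (inj₂ _)   (inj₁ y≡p) (inj₁ z≡p) y≢z = ⊥-elim (y≢z (trans y≡p (sym z≡p)))

  mutualVisibility⇒∣∩C∣≤3 : (X : VSubset G) → MutualVisibility G X →
    (C : InducedC4 G) → ∣ X ∩C C ∣ ≤ 3
  mutualVisibility⇒∣∩C∣≤3 X mv C = Equivalence.from (∣∩C∣≤3⇔¬All X C) all⇒⊥
    where
    open InducedC4 C
    all⇒⊥ : ¬ All (λ v → X v ≡ true) (cycleVerts C)
    all⇒⊥ (v0∈X ∷ v1∈X ∷ v2∈X ∷ v3∈X ∷ []) with
      visible⇒detour∉ X irreflexive d02 n02 e01 e12 (mv v0 v2 v0∈X v2∈X d02)
    ... | m , v0m , mv2 , m∉X with C4-common-neighbour C v0m mv2
    ... | inj₁ refl = m∉X v1∈X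
    ... | inj₂ refl = m∉X v3∈X

  ∣∩C∣≤3⇒mutualVisibility : (X : VSubset G) → (∀ (C : InducedC4 G) → ∣ X ∩C C ∣ ≤ 3) →
    MutualVisibility G X
  ∣∩C∣≤3⇒mutualVisibility X sparse (a , b) (c , d) ab∈X cd∈X ne with a ≟ c | b ≟ d
  ... | yes refl | yes refl = ⊥-elim (ne refl)
  ... | yes refl | no b≢d   = edge-visible X ne (inj₂ (refl , b≢d))
  ... | no a≢c   | yes refl = edge-visible X ne (inj₁ (a≢c , refl))
  ... | no a≢c   | no b≢d   with X (a , d) ≟ᵇ true | X (c , b) ≟ᵇ true
  ... | no ad∉X  | _        =
    detour-visible X ne (InducedC4.n02 C) (inj₂ (refl , b≢d)) (inj₁ (a≢c , refl)) ad∉X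
    where C = rectangle a≢c b≢d
  ... | yes _    | no cb∉X  =
    detour-visible X ne (InducedC4.n02 C) (inj₁ (a≢c , refl)) (inj₂ (refl , b≢d)) cb∉X
    where C = rectangle a≢c b≢d
  ... | yes ad∈X | yes cb∈X =
    ⊥-elim (Equivalence.to (∣∩C∣≤3⇔¬All X C) (sparse C) (ab∈X ∷ ad∈X ∷ cd∈X ∷ cb∈X ∷ []))
    where C = rectangle a≢c b≢d

lemma3p5 : (r s : ℕ) → 2 ≤ r → 2 ≤ s → (X : VSubset (K r □ K s)) →
    MutualVisibility (K r □ K s) X ⇔ (∀ (C : InducedC4 (K r □ K s)) → ∣ X ∩C C ∣ ≤ 3)
lemma3p5 r s _ _ X = mk⇔ (mutualVisibility⇒∣∩C∣≤3 X) (∣∩C∣≤3⇒mutualVisibility X)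
  where open Rook r s
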